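{- Let $C$ be a smooth combinatorial cube of dimension $d\geq 3$ in $\mathbb{R}^d$, and suppose that every smooth combinatorial cube of dimension $d'$ with $2\le d'<d$ has two parallel facets. Fix $x,y\in[d]$ with $x\neq y$, and suppose that the four $(d-2)$-dimensional faces $F_{xy}$, $F_{x\bar y}$, $F_{\bar x y}$, $F_{\bar x\bar y}$ are all parallel to one another. Then either $F_x$ is parallel to $F_{\bar x}$ or $F_y$ is parallel to $F_{\bar y}$.
   Context: A $d$-dimensional combinatorial cube $C$ is a polytope whose face poset is isomorphic to that of $[0,1]^d$; fix such an isomorphism. For disjoint $I,J\subseteq[d]$, $F_I^J$ denotes the face of $C$ corresponding to $\{x\in[0,1]^d : x_k=0 \text{ for } k\in I,\ x_k=1\text{ for }k\in J\}$. Shorthand: indices in $I$ are written plainly and indices in $J$ with a bar, e.g. $F_{x\bar y}=F_{\{x\}}^{\{y\}}$, $F_x=F_{\{x\}}^{\emptyset}$, $F_{\bar x}=F_{\emptyset}^{\{x\}}$. A $d$-dimensional polytope in $\mathbb{R}^d$ is smooth if it is a lattice polytope, each vertex lies on exactly $d$ edges, and the primitive edge directions at each vertex form a basis of $\mathbb{Z}^d$ (for lower-dimensional cubes, smoothness is with respect to the lattice of their own dimension). Faces are parallel if the linear subspaces parallel to their affine hulls coincide. -}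

module Defs where

open import Data.Nat using (ℕ; zero; suc)
open import Data.Integer using (ℤ; _+_; _-_; _*_; _≤_; ∣_∣) renaming (+_ to ℤ+)
open import Data.Bool using (Bool; true; false)
open import Data.Maybe using (Maybe; just; nothing)
open import Data.Fin using (Fin)
open import Data.Vec using (Vec; []; _∷_; zipWith; map; replicate; _[_]≔_)
open import Data.List using (List; _++_) renaming ([] to [ₗ]; _∷_ to _∷ₗ_; map to mapₗ; foldr to foldrₗ; concatMap to concatMapₗ)
open import Data.Product using (Σ; ∃; _×_; _,_)
open import Data.Unit using (⊤)
open import Relation.Binary.PropositionalEquality using (_≡_; _≢_)

Pt : ℕ → Set
Pt d = Vec ℤ d

0ᵥ : ∀ {d} → Pt d
0ᵥ = replicate _ (ℤ+ 0)

_+ᵥ_ : ∀ {d} → Pt d → Pt d → Pt d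
_+ᵥ_ = zipWith _+_

_-ᵥ_ : ∀ {d} → Pt d → Pt d → Pt d
_-ᵥ_ = zipWith _-_

_•_ : ∀ {d} → ℤ → Pt d → Pt d
m • u = map (m *_) u

dot : ∀ {d} → Pt d → Pt d → ℤ
dot [] [] = ℤ+ 0
dot (a ∷ u) (b ∷ w) = a * b + dot u w

lincomb : ∀ {d} (n : ℕ) → (Fin n → ℤ) → (Fin n → Pt d) → Pt d
lincomb zero a p = 0ᵥ
lincomb (suc n) a p = (a Fin.zero • p Fin.zero) +ᵥ lincomb n (λ k → a (Fin.suc k)) (λ k → p (Fin.suc k))

sumᵥ : ∀ {d} → List (Pt d) → Pt d
sumᵥ = foldrₗ _+ᵥ_ 0ᵥ

-- Labels of cube vertices: {0,1}^d  (false = 0, true = 1)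

Label : ℕ → Set
Label d = Vec Bool d

allLabels : (d : ℕ) → List (Label d)
allLabels zero = [] ∷ₗ [ₗ]
allLabels (suc d) = mapₗ (false ∷_) (allLabels d) ++ mapₗ (true ∷_) (allLabels d)

-- A face F_I^J of [0,1]^d is encoded by a partial assignment σ :
-- σ k = just false  (k ∈ I, x_k = 0), σ k = just true (k ∈ J, x_k = 1),
-- σ k = nothing (coordinate k free).
CubeFace : ℕ → Set
CubeFace d = Vec (Maybe Bool) d

InFace : ∀ {d} → CubeFace d → Label d → Set
InFace [] [] = ⊤
InFace (nothing ∷ σ) (b ∷ ε) = InFace σ ε
InFace (just a ∷ σ) (b ∷ ε) = (a ≡ b) × InFace σ ε

fixedCount : ∀ {d} → CubeFace d → ℕ
fixedCount [] = 0
fixedCount (nothing ∷ σ) = fixedCount σ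
fixedCount (just _ ∷ σ) = suc (fixedCount σ)

IsFacet : ∀ {d} → CubeFace d → Set
IsFacet σ = fixedCount σ ≡ 1

-- F_x (a = false) or F_{x̄} (a = true)
F1 : ∀ {d} → Fin d → Bool → CubeFace d
F1 {d} x a = replicate d nothing [ x ]≔ just a

-- F with x fixed to a and y fixed to b, e.g. F_{x ȳ} = F2 x false y true
F2 : ∀ {d} → Fin d → Bool → Fin d → Bool → CubeFace d
F2 x a y b = F1 x a [ y ]≔ just b

-- A polytope given as conv{ v ε : ε ∈ {0,1}^d } ⊆ ℝ^d with v : Label d → ℤ^d.

Vertices : ℕ → Set
Vertices d = Label d → Pt d

IsMax : ∀ {d} → Vertices d → Pt d → Label d → Set
IsMax v c ε = ∀ ε' → dot c (v ε') ≤ dot c (v ε)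

-- Faces of conv(v) are exactly the argmax sets of linear functionals.
-- v is a combinatorial cube, with the face-poset isomorphism given by the
-- labelling, iff the argmax sets (as sets of labels) are exactly the
-- vertex sets of the faces F_I^J of [0,1]^d.
IsCombCube : ∀ {d} → Vertices d → Set
IsCombCube {d} v =
  (∀ (σ : CubeFace d) → ∃ λ (c : Pt d) →
      ∀ ε → (IsMax v c ε → InFace σ ε) × (InFace σ ε → IsMax v c ε))
  × (∀ (c : Pt d) → ∃ λ (σ : CubeFace d) →
      ∀ ε → (IsMax v c ε → InFace σ ε) × (InFace σ ε → IsMax v c ε))

flip : ∀ {d} → Label d → Fin d → Label d
flip (b ∷ ε) Fin.zero = Data.Bool.not b ∷ ε
flip (b ∷ ε) (Fin.suc k) = b ∷ flip ε k

IsPrimitive : ∀ {d} → Pt d → Set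
IsPrimitive p = (p ≢ 0ᵥ) × (∀ (n : ℤ) (q : _) → p ≡ n • q → ∣ n ∣ ≡ 1)

PrimitiveDirOf : ∀ {d} → Pt d → Pt d → Set
PrimitiveDirOf u p = IsPrimitive p × ∃ λ (m : ℕ) → u ≡ ℤ+ (suc m) • p

IsBasis : ∀ {d} → (Fin d → Pt d) → Set
IsBasis {d} p =
  (∀ (w : Pt d) → ∃ λ (a : Fin d → ℤ) → w ≡ lincomb d a p)
  × (∀ (a : Fin d → ℤ) → lincomb d a p ≡ 0ᵥ → ∀ k → a k ≡ ℤ+ 0)

-- Smoothness of a lattice combinatorial cube: at each vertex ε the d edges go
-- to the vertices flip ε k, and their primitive directions form a basis of ℤ^d.
IsSmooth : ∀ {d} → Vertices d → Set
IsSmooth {d} v = ∀ (ε : Label d) → ∃ λ (p : Fin d → Pt d) →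
  (∀ k → PrimitiveDirOf (v (flip ε k) -ᵥ v ε) (p k)) × IsBasis p

-- The linear space parallel to aff(face σ) is the real span of
-- { v ε - v ε' : ε, ε' ∈ σ }.  Since the generators are integral, a vector w is
-- in that real span iff m • w is an integer combination of them for some
-- integer m ≠ 0 (the rational span).

InDirSpace : ∀ {d} → Vertices d → CubeFace d → Pt d → Set
InDirSpace {d} v σ w =
  Σ ℤ λ m → (m ≢ ℤ+ 0) × Σ (Label d → Label d → ℤ) λ c →
    (∀ ε ε' → c ε ε' ≢ ℤ+ 0 → InFace σ ε × InFace σ ε')
    × (m • w ≡ sumᵥ (concatMapₗ (λ ε → mapₗ (λ ε' → c ε ε' • (v ε -ᵥ v ε')) (allLabels d)) (allLabels d)))

Parallel : ∀ {d} → Vertices d → CubeFace d → CubeFace d → Set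
Parallel v σ τ =
  (∀ ε ε' → InFace σ ε → InFace σ ε' → InDirSpace v τ (v ε -ᵥ v ε'))
  × (∀ ε ε' → InFace τ ε → InFace τ ε' → InDirSpace v σ (v ε -ᵥ v ε'))

HasParallelFacets : ∀ {d} → Vertices d → Set
HasParallelFacets {d} v = Σ (CubeFace d) λ σ → Σ (CubeFace d) λ τ →
  IsFacet σ × IsFacet τ × (σ ≢ τ) × Parallel v σ τ

-- Take lattice coordinates at the vertex o = (0,…,0) whose axes are the primitive edge
-- directions at o. An edge of C in a direction other than x and y lies in one of the faces
-- F_{x?y?}, and these are all parallel to F_{xy}, so its x- and y-coordinates vanish.
-- Projecting to these two coordinates therefore maps the 2-face of C through o in the
-- directions x and y onto a lattice quadrilateral with sides (1,0), (0,1) at o and (α,1),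
-- (1,β) at the opposite vertex, and smoothness there becomes |1 − αβ| = 1. Closing up the
-- quadrilateral and convexity exclude αβ = 2, so α = 0 or β = 0. If α = 0, the normal of
-- F_x̄ is a multiple of the x-coordinate, which makes F_x and F_x̄ parallel.

module Submission where

open import Defs
open import Data.Nat using (ℕ; _≤_; _<_)
open import Data.Fin using (Fin)
open import Data.Bool using (Bool; true; false; not)
open import Data.Bool.Properties using (not-¬)
open import Data.Sum using (_⊎_)
open import Relation.Binary.PropositionalEquality using (_≢_)

import Data.Nat as ℕ
import Data.Nat.Properties as ℕP
open import Data.Integer as ℤ
  using (ℤ; _+_; _*_; _-_; -_; +0; -[1+_]; +[1+_]; 0ℤ; 1ℤ; -1ℤ; ∣_∣) renaming (_<_ to _<ℤ_; _≤_ to _≤ℤ_)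
import Data.Integer.Properties as ℤP
open import Data.Integer.Tactic.RingSolver using (solve; solve-∀)
open import Algebra.Properties.Monoid.Sum ℤP.+-0-monoid using (sum; sum-syntax; sum-cong-≗; sum-replicate-zero)
open import Data.Fin as Fin using (zero; suc)
import Data.Fin.Properties as FinP
open import Data.Vec using ([]; _∷_; lookup; replicate; _[_]≔_)
import Data.Vec.Properties as VecP
open import Data.List as List using (List; concatMap) renaming ([] to []ₗ; _∷_ to _∷ₗ_; _++_ to _++ₗ_)
import Data.List.Properties as ListP
open import Data.Maybe using (just; nothing)
open import Data.Product using (∃; _×_; _,_; proj₁; proj₂)
open import Data.Sum using (inj₁; inj₂; [_,_])
open import Data.Empty using (⊥-elim)
open import Data.Unit using (tt)
open import Function using (_∘_)
open import Relation.Nullary using (¬_; Dec; yes; no; contradiction; _×-dec_)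
open import Relation.Binary.PropositionalEquality
  using (_≡_; refl; sym; trans; cong; cong₂; subst; subst₂; ≢-sym; module ≡-Reasoning)

private
  variable
    d n : ℕ

i*j≡0⇒j≡0 : ∀ {i j} → i ≢ 0ℤ → i * j ≡ 0ℤ → j ≡ 0ℤ
i*j≡0⇒j≡0 {i} i≢0 ij≡0 =
  [ (λ i≡0 → contradiction i≡0 i≢0) , (λ j≡0 → j≡0) ] (ℤP.i*j≡0⇒i≡0∨j≡0 i ij≡0)

i*j≢0 : ∀ {i j} → i ≢ 0ℤ → j ≢ 0ℤ → i * j ≢ 0ℤ
i*j≢0 {i} i≢0 j≢0 ij≡0 = j≢0 (i*j≡0⇒j≡0 i≢0 ij≡0)

i*j≡0⇒i≡0 : ∀ {i j} → j ≢ 0ℤ → i * j ≡ 0ℤ → i ≡ 0ℤ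
i*j≡0⇒i≡0 {i} {j} j≢0 ij≡0 = i*j≡0⇒j≡0 j≢0 (trans (ℤP.*-comm j i) ij≡0)

i<j⇒i-j<0 : ∀ {i j} → i <ℤ j → i - j <ℤ 0ℤ
i<j⇒i-j<0 {i} {j} i<j = subst (i - j <ℤ_) (ℤP.+-inverseʳ j) (ℤP.+-monoˡ-< (- j) i<j)

i<j⇒0<j-i : ∀ {i j} → i <ℤ j → 0ℤ <ℤ j - i
i<j⇒0<j-i {i} {j} i<j = subst (_<ℤ j - i) (ℤP.+-inverseʳ i) (ℤP.+-monoˡ-< (- i) i<j)

∣i∣≡1∧0<i⇒i≡1 : ∀ {i} → ∣ i ∣ ≡ 1 → 0ℤ <ℤ i → i ≡ 1ℤ
∣i∣≡1∧0<i⇒i≡1 {ℤ.+ n} ∣i∣≡1 _ = cong ℤ.+_ ∣i∣≡1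

0<i*j∧0<i⇒0<j : ∀ {i j} → 0ℤ <ℤ i * j → 0ℤ <ℤ i → 0ℤ <ℤ j
0<i*j∧0<i⇒0<j {i} {j} 0<ij 0<i =
  ℤP.*-cancelˡ-<-nonNeg i {{ℤ.nonNegative (ℤP.<⇒≤ 0<i)}} (subst (_<ℤ i * j) (sym (ℤP.*-zeroʳ i)) 0<ij)

0<+[1+m]*i⇒0<i : ∀ m {i} → 0ℤ <ℤ +[1+ m ] * i → 0ℤ <ℤ i
0<+[1+m]*i⇒0<i m {i} 0<mi = ℤP.*-cancelˡ-<-nonNeg +[1+ m ] (subst (_<ℤ +[1+ m ] * i) (sym (ℤP.*-zeroʳ +[1+ m ])) 0<mi)

+[1+m]*i<0⇒i<0 : ∀ m {i} → +[1+ m ] * i <ℤ 0ℤ → i <ℤ 0ℤ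
+[1+m]*i<0⇒i<0 m {i} mi<0 = ℤP.*-cancelˡ-<-nonNeg +[1+ m ] (subst (+[1+ m ] * i <ℤ_) (sym (ℤP.*-zeroʳ +[1+ m ])) mi<0)

i*j<0∧j<0⇒0<i : ∀ {i j} → i * j <ℤ 0ℤ → j <ℤ 0ℤ → 0ℤ <ℤ i
i*j<0∧j<0⇒0<i {i} {j} ij<0 j<0 =
  ℤP.*-cancelʳ-<-nonPos j {{ℤ.nonPositive (ℤP.<⇒≤ j<0)}} (subst (i * j <ℤ_) (sym (ℤP.*-zeroˡ j)) ij<0)


+ᵥ-identityˡ : (u : Pt d) → 0ᵥ +ᵥ u ≡ u
+ᵥ-identityˡ = VecP.zipWith-identityˡ ℤP.+-identityˡ

+ᵥ-identityʳ : (u : Pt d) → u +ᵥ 0ᵥ ≡ u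
+ᵥ-identityʳ = VecP.zipWith-identityʳ ℤP.+-identityʳ

+ᵥ-assoc : (u w z : Pt d) → (u +ᵥ w) +ᵥ z ≡ u +ᵥ (w +ᵥ z)
+ᵥ-assoc = VecP.zipWith-assoc ℤP.+-assoc

+ᵥ-interchange : (u w z t : Pt d) → (u +ᵥ w) +ᵥ (z +ᵥ t) ≡ (u +ᵥ z) +ᵥ (w +ᵥ t)
+ᵥ-interchange [] [] [] [] = refl
+ᵥ-interchange (a ∷ u) (b ∷ w) (c ∷ z) (e ∷ t) =
  cong₂ _∷_ (solve (a ∷ₗ b ∷ₗ c ∷ₗ e ∷ₗ []ₗ)) (+ᵥ-interchange u w z t)

•-zeroˡ : (u : Pt d) → 0ℤ • u ≡ 0ᵥ
•-zeroˡ [] = refl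
•-zeroˡ (a ∷ u) = cong (0ℤ ∷_) (•-zeroˡ u)

•-zeroʳ : (m : ℤ) → m • 0ᵥ {d} ≡ 0ᵥ
•-zeroʳ {ℕ.zero} m = refl
•-zeroʳ {ℕ.suc d} m = cong₂ _∷_ (ℤP.*-zeroʳ m) (•-zeroʳ m)

•-identityˡ : (u : Pt d) → 1ℤ • u ≡ u
•-identityˡ [] = refl
•-identityˡ (a ∷ u) = cong₂ _∷_ (ℤP.*-identityˡ a) (•-identityˡ u)

•-assoc : (m n : ℤ) (u : Pt d) → (m * n) • u ≡ m • (n • u)
•-assoc m n [] = refl
•-assoc m n (a ∷ u) = cong₂ _∷_ (ℤP.*-assoc m n a) (•-assoc m n u)

•-comm : (m n : ℤ) (u : Pt d) → m • (n • u) ≡ n • (m • u)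
•-comm m n [] = refl
•-comm m n (a ∷ u) = cong₂ _∷_ (solve (m ∷ₗ n ∷ₗ a ∷ₗ []ₗ)) (•-comm m n u)

•-distribˡ : (m : ℤ) (u w : Pt d) → m • (u +ᵥ w) ≡ (m • u) +ᵥ (m • w)
•-distribˡ m [] [] = refl
•-distribˡ m (a ∷ u) (b ∷ w) = cong₂ _∷_ (ℤP.*-distribˡ-+ m a b) (•-distribˡ m u w)

•-distribʳ : (m n : ℤ) (u : Pt d) → (m + n) • u ≡ (m • u) +ᵥ (n • u)
•-distribʳ m n [] = refl
•-distribʳ m n (a ∷ u) = cong₂ _∷_ (ℤP.*-distribʳ-+ a m n) (•-distribʳ m n u)

-ᵥ-as-+ᵥ : (u w : Pt d) → u -ᵥ w ≡ u +ᵥ (-1ℤ • w)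
-ᵥ-as-+ᵥ [] [] = refl
-ᵥ-as-+ᵥ (a ∷ u) (b ∷ w) = cong₂ _∷_ (solve (a ∷ₗ b ∷ₗ []ₗ)) (-ᵥ-as-+ᵥ u w)

-ᵥ-+ᵥ-cancel : (u w : Pt d) → (u -ᵥ w) +ᵥ w ≡ u
-ᵥ-+ᵥ-cancel [] [] = refl
-ᵥ-+ᵥ-cancel (a ∷ u) (b ∷ w) = cong₂ _∷_ (solve (a ∷ₗ b ∷ₗ []ₗ)) (-ᵥ-+ᵥ-cancel u w)

sumᵥ-++ : (us ws : List (Pt d)) → sumᵥ (us ++ₗ ws) ≡ sumᵥ us +ᵥ sumᵥ ws
sumᵥ-++ []ₗ ws = sym (+ᵥ-identityˡ (sumᵥ ws))
sumᵥ-++ (u ∷ₗ us) ws = trans (cong (u +ᵥ_) (sumᵥ-++ us ws)) (sym (+ᵥ-assoc u (sumᵥ us) (sumᵥ ws)))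

module _ {A : Set} where

  sumᵥ-concatMap : (f : A → List (Pt d)) (xs : List A) →
                   sumᵥ (concatMap f xs) ≡ sumᵥ (List.map (sumᵥ ∘ f) xs)
  sumᵥ-concatMap f []ₗ = refl
  sumᵥ-concatMap f (x ∷ₗ xs) =
    trans (sumᵥ-++ (f x) (concatMap f xs)) (cong (sumᵥ (f x) +ᵥ_) (sumᵥ-concatMap f xs))

  sumᵥ-map-+ᵥ : (f g : A → Pt d) (xs : List A) →
                sumᵥ (List.map (λ a → f a +ᵥ g a) xs) ≡ sumᵥ (List.map f xs) +ᵥ sumᵥ (List.map g xs)
  sumᵥ-map-+ᵥ f g []ₗ = sym (+ᵥ-identityʳ 0ᵥ)
  sumᵥ-map-+ᵥ f g (x ∷ₗ xs) =
    trans (cong ((f x +ᵥ g x) +ᵥ_) (sumᵥ-map-+ᵥ f g xs)) (+ᵥ-interchange (f x) (g x) _ _)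

  sumᵥ-map-• : (m : ℤ) (f : A → Pt d) (xs : List A) →
               sumᵥ (List.map (λ a → m • f a) xs) ≡ m • sumᵥ (List.map f xs)
  sumᵥ-map-• m f []ₗ = sym (•-zeroʳ m)
  sumᵥ-map-• m f (x ∷ₗ xs) =
    trans (cong ((m • f x) +ᵥ_) (sumᵥ-map-• m f xs)) (sym (•-distribˡ m (f x) _))

  sumᵥ-map-closed : (P : Pt d → Set) → P 0ᵥ → (∀ {u w} → P u → P w → P (u +ᵥ w)) →
                    (f : A → Pt d) → (∀ a → P (f a)) → ∀ xs → P (sumᵥ (List.map f xs))
  sumᵥ-map-closed P P0 P+ f Pf []ₗ = P0
  sumᵥ-map-closed P P0 P+ f Pf (x ∷ₗ xs) = P+ (Pf x) (sumᵥ-map-closed P P0 P+ f Pf xs)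

  sumᵥ-map-0ᵥ : (f : A → Pt d) → (∀ a → f a ≡ 0ᵥ) → ∀ xs → sumᵥ (List.map f xs) ≡ 0ᵥ
  sumᵥ-map-0ᵥ = sumᵥ-map-closed (_≡ 0ᵥ) refl (λ u≡0 w≡0 → trans (cong₂ _+ᵥ_ u≡0 w≡0) (+ᵥ-identityʳ 0ᵥ))

sumᵥ-allLabels-single : (f : Label d → Pt n) (e₀ : Label d) → (∀ e → e ≢ e₀ → f e ≡ 0ᵥ) →
                        sumᵥ (List.map f (allLabels d)) ≡ f e₀
sumᵥ-allLabels-single {ℕ.zero} f [] _ = +ᵥ-identityʳ (f [])
sumᵥ-allLabels-single {ℕ.suc d} f (b ∷ e₀) f≡0 = begin
  sumᵥ (List.map f (List.map (false ∷_) L ++ₗ List.map (true ∷_) L))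
    ≡⟨ cong sumᵥ (ListP.map-++ f (List.map (false ∷_) L) _) ⟩
  sumᵥ (List.map f (List.map (false ∷_) L) ++ₗ List.map f (List.map (true ∷_) L))
    ≡⟨ sumᵥ-++ (List.map f (List.map (false ∷_) L)) _ ⟩
  sumᵥ (List.map f (List.map (false ∷_) L)) +ᵥ sumᵥ (List.map f (List.map (true ∷_) L))
    ≡⟨ sym (cong₂ _+ᵥ_ (cong sumᵥ (ListP.map-∘ L)) (cong sumᵥ (ListP.map-∘ L))) ⟩
  sumᵥ (List.map (f ∘ (false ∷_)) L) +ᵥ sumᵥ (List.map (f ∘ (true ∷_)) L)
    ≡⟨ halves b f≡0 ⟩
  f (b ∷ e₀) ∎
  where
  open ≡-Reasoning
  L : List (Label d)
  L = allLabels d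
  tail≢ : ∀ {b c e} → e ≢ e₀ → c ∷ e ≢ b ∷ e₀
  tail≢ e≢e₀ eq = e≢e₀ (VecP.∷-injectiveʳ eq)
  halves : ∀ b → (∀ e → e ≢ b ∷ e₀ → f e ≡ 0ᵥ) →
           sumᵥ (List.map (f ∘ (false ∷_)) L) +ᵥ sumᵥ (List.map (f ∘ (true ∷_)) L) ≡ f (b ∷ e₀)
  halves false f≡0 = trans
    (cong₂ _+ᵥ_ (sumᵥ-allLabels-single (f ∘ (false ∷_)) e₀ (λ e → f≡0 _ ∘ tail≢))
                (sumᵥ-map-0ᵥ (f ∘ (true ∷_)) (λ e → f≡0 _ (λ ())) L))
    (+ᵥ-identityʳ _)
  halves true f≡0 = trans
    (cong₂ _+ᵥ_ (sumᵥ-map-0ᵥ (f ∘ (false ∷_)) (λ e → f≡0 _ (λ ())) L)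
                (sumᵥ-allLabels-single (f ∘ (true ∷_)) e₀ (λ e → f≡0 _ ∘ tail≢)))
    (+ᵥ-identityˡ _)

module _ {A B : Set} where

  pairSum : List A → List B → (A → B → Pt d) → Pt d
  pairSum xs ys t = sumᵥ (concatMap (λ a → List.map (t a) ys) xs)

  pairSum-as-sumᵥ : (xs : List A) (ys : List B) (t : A → B → Pt d) →
                    pairSum xs ys t ≡ sumᵥ (List.map (λ a → sumᵥ (List.map (t a) ys)) xs)
  pairSum-as-sumᵥ xs ys t = sumᵥ-concatMap (λ a → List.map (t a) ys) xs

  pairSum-cong : (xs : List A) (ys : List B) {s t : A → B → Pt d} →
                 (∀ a b → s a b ≡ t a b) → pairSum xs ys s ≡ pairSum xs ys t
  pairSum-cong xs ys {s} {t} s≡t = begin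
    pairSum xs ys s
      ≡⟨ pairSum-as-sumᵥ xs ys s ⟩
    sumᵥ (List.map (λ a → sumᵥ (List.map (s a) ys)) xs)
      ≡⟨ cong sumᵥ (ListP.map-cong (λ a → cong sumᵥ (ListP.map-cong (s≡t a) ys)) xs) ⟩
    sumᵥ (List.map (λ a → sumᵥ (List.map (t a) ys)) xs)
      ≡⟨ sym (pairSum-as-sumᵥ xs ys t) ⟩
    pairSum xs ys t ∎
    where open ≡-Reasoning

  pairSum-+ᵥ : (xs : List A) (ys : List B) (s t : A → B → Pt d) →
               pairSum xs ys (λ a b → s a b +ᵥ t a b) ≡ pairSum xs ys s +ᵥ pairSum xs ys t
  pairSum-+ᵥ {d} xs ys s t = begin
    pairSum xs ys (λ a b → s a b +ᵥ t a b)
      ≡⟨ pairSum-as-sumᵥ xs ys _ ⟩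
    sumᵥ (List.map (λ a → sumᵥ (List.map (λ b → s a b +ᵥ t a b) ys)) xs)
      ≡⟨ cong sumᵥ (ListP.map-cong (λ a → sumᵥ-map-+ᵥ (s a) (t a) ys) xs) ⟩
    sumᵥ (List.map (λ a → S a +ᵥ T a) xs)
      ≡⟨ sumᵥ-map-+ᵥ S T xs ⟩
    sumᵥ (List.map S xs) +ᵥ sumᵥ (List.map T xs)
      ≡⟨ sym (cong₂ _+ᵥ_ (pairSum-as-sumᵥ xs ys s) (pairSum-as-sumᵥ xs ys t)) ⟩
    pairSum xs ys s +ᵥ pairSum xs ys t ∎
    where
    open ≡-Reasoning
    S T : A → Pt d
    S a = sumᵥ (List.map (s a) ys)
    T a = sumᵥ (List.map (t a) ys)

  pairSum-• : (m : ℤ) (xs : List A) (ys : List B) (t : A → B → Pt d) →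
              pairSum xs ys (λ a b → m • t a b) ≡ m • pairSum xs ys t
  pairSum-• m xs ys t = begin
    pairSum xs ys (λ a b → m • t a b)
      ≡⟨ pairSum-as-sumᵥ xs ys _ ⟩
    sumᵥ (List.map (λ a → sumᵥ (List.map (λ b → m • t a b) ys)) xs)
      ≡⟨ cong sumᵥ (ListP.map-cong (λ a → sumᵥ-map-• m (t a) ys) xs) ⟩
    sumᵥ (List.map (λ a → m • sumᵥ (List.map (t a) ys)) xs)
      ≡⟨ sumᵥ-map-• m _ xs ⟩
    m • sumᵥ (List.map (λ a → sumᵥ (List.map (t a) ys)) xs)
      ≡⟨ sym (cong (m •_) (pairSum-as-sumᵥ xs ys t)) ⟩
    m • pairSum xs ys t ∎
    where open ≡-Reasoning

  pairSum-closed : (P : Pt d → Set) → P 0ᵥ → (∀ {u w} → P u → P w → P (u +ᵥ w)) →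
                   (xs : List A) (ys : List B) (t : A → B → Pt d) → (∀ a b → P (t a b)) →
                   P (pairSum xs ys t)
  pairSum-closed P P0 P+ xs ys t Pt = subst P (sym (pairSum-as-sumᵥ xs ys t))
    (sumᵥ-map-closed P P0 P+ _ (λ a → sumᵥ-map-closed P P0 P+ (t a) (Pt a) ys) xs)

pairSum-allLabels-single : (t : Label d → Label d → Pt n) (e₀ e₀′ : Label d) →
                           (∀ e e′ → ¬ (e ≡ e₀ × e′ ≡ e₀′) → t e e′ ≡ 0ᵥ) →
                           pairSum (allLabels d) (allLabels d) t ≡ t e₀ e₀′
pairSum-allLabels-single {d} t e₀ e₀′ t≡0 = begin
  pairSum L L t
    ≡⟨ pairSum-as-sumᵥ L L t ⟩
  sumᵥ (List.map (λ e → sumᵥ (List.map (t e) L)) L)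
    ≡⟨ sumᵥ-allLabels-single _ e₀ (λ e e≢e₀ →
         sumᵥ-map-0ᵥ (t e) (λ e′ → t≡0 e e′ (e≢e₀ ∘ proj₁)) L) ⟩
  sumᵥ (List.map (t e₀) L)
    ≡⟨ sumᵥ-allLabels-single (t e₀) e₀′ (λ e′ e′≢e₀′ → t≡0 e₀ e′ (e′≢e₀′ ∘ proj₂)) ⟩
  t e₀ e₀′ ∎
  where
  open ≡-Reasoning
  L : List (Label d)
  L = allLabels d

sum-single : (f : Fin n → ℤ) (i : Fin n) → (∀ k → k ≢ i → f k ≡ 0ℤ) → ∑[ k < n ] f k ≡ f i
sum-single {ℕ.suc n} f zero f≡0 =
  trans (cong (f zero +_) (trans (sum-cong-≗ (λ k → f≡0 (suc k) (λ ()))) (sum-replicate-zero n)))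
        (ℤP.+-identityʳ (f zero))
sum-single {ℕ.suc n} f (suc i) f≡0 =
  trans (cong₂ _+_ (f≡0 zero (λ ())) (sum-single (f ∘ suc) i (λ k k≢i → f≡0 (suc k) (k≢i ∘ FinP.suc-injective))))
        (ℤP.+-identityˡ (f (suc i)))

sum-pair : (f : Fin n → ℤ) (i j : Fin n) → i ≢ j → (∀ k → k ≢ i → k ≢ j → f k ≡ 0ℤ) →
           ∑[ k < n ] f k ≡ f i + f j
sum-pair f zero zero i≢j _ = contradiction refl i≢j
sum-pair f zero (suc j) _ f≡0 =
  cong (f zero +_) (sum-single (f ∘ suc) j (λ k k≢j → f≡0 (suc k) (λ ()) (k≢j ∘ FinP.suc-injective)))
sum-pair f (suc i) zero _ f≡0 = trans
  (cong (f zero +_) (sum-single (f ∘ suc) i (λ k k≢i → f≡0 (suc k) (k≢i ∘ FinP.suc-injective) (λ ()))))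
  (ℤP.+-comm (f zero) (f (suc i)))
sum-pair f (suc i) (suc j) i≢j f≡0 = trans
  (cong₂ _+_ (f≡0 zero (λ ()) (λ ()))
             (sum-pair (f ∘ suc) i j (i≢j ∘ cong suc)
                       (λ k k≢i k≢j → f≡0 (suc k) (k≢i ∘ FinP.suc-injective) (k≢j ∘ FinP.suc-injective))))
  (ℤP.+-identityˡ _)

record Linear (φ : Pt d → ℤ) : Set where
  field
    +ᵥ-homo : ∀ u w → φ (u +ᵥ w) ≡ φ u + φ w
    •-homo  : ∀ m u → φ (m • u) ≡ m * φ u

  0ᵥ-homo : φ 0ᵥ ≡ 0ℤ
  0ᵥ-homo = trans (cong φ (sym (•-zeroˡ 0ᵥ))) (•-homo 0ℤ 0ᵥ)

  -ᵥ-homo : ∀ u w → φ (u -ᵥ w) ≡ φ u - φ w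
  -ᵥ-homo u w = begin
    φ (u -ᵥ w)           ≡⟨ cong φ (-ᵥ-as-+ᵥ u w) ⟩
    φ (u +ᵥ (-1ℤ • w))   ≡⟨ +ᵥ-homo u _ ⟩
    φ u + φ (-1ℤ • w)    ≡⟨ cong (φ u +_) (•-homo -1ℤ w) ⟩
    φ u + -1ℤ * φ w      ≡⟨ cong (φ u +_) (ℤP.-1*i≡-i (φ w)) ⟩
    φ u - φ w            ∎
    where open ≡-Reasoning

  -ᵥ-telescope : ∀ u z w → φ (u -ᵥ w) ≡ φ (u -ᵥ z) + φ (z -ᵥ w)
  -ᵥ-telescope u z w = begin
    φ (u -ᵥ w)                    ≡⟨ -ᵥ-homo u w ⟩
    φ u - φ w                     ≡⟨ telescope (φ u) (φ z) (φ w) ⟩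
    (φ u - φ z) + (φ z - φ w)     ≡⟨ sym (cong₂ _+_ (-ᵥ-homo u z) (-ᵥ-homo z w)) ⟩
    φ (u -ᵥ z) + φ (z -ᵥ w)       ∎
    where
    open ≡-Reasoning
    telescope : ∀ a b c → a - c ≡ (a - b) + (b - c)
    telescope = solve-∀

  -ᵥ-antisym : ∀ u w → φ (w -ᵥ u) ≡ - φ (u -ᵥ w)
  -ᵥ-antisym u w = trans (-ᵥ-homo w u) (trans (swap (φ u) (φ w)) (cong -_ (sym (-ᵥ-homo u w))))
    where
    swap : ∀ a b → b - a ≡ - (a - b)
    swap = solve-∀

  lincomb-homo : ∀ n (a : Fin n → ℤ) q → φ (lincomb n a q) ≡ ∑[ k < n ] (a k * φ (q k))
  lincomb-homo ℕ.zero a q = 0ᵥ-homo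
  lincomb-homo (ℕ.suc n) a q = trans (+ᵥ-homo _ _)
    (cong₂ _+_ (•-homo (a zero) (q zero)) (lincomb-homo n (a ∘ suc) (q ∘ suc)))

lincomb-closed : (P : Pt d → Set) → P 0ᵥ → (∀ {u w} → P u → P w → P (u +ᵥ w)) →
                 ∀ n (a : Fin n → ℤ) q → (∀ k → P (a k • q k)) → P (lincomb n a q)
lincomb-closed P P0 P+ ℕ.zero a q Pterm = P0
lincomb-closed P P0 P+ (ℕ.suc n) a q Pterm = P+ (Pterm zero) (lincomb-closed P P0 P+ n (a ∘ suc) (q ∘ suc) (Pterm ∘ suc))

dot-linear : (c : Pt d) → Linear (dot c)
dot-linear c = record { +ᵥ-homo = dot-+ᵥ c ; •-homo = λ m u → dot-• c m u }
  where
  dot-+ᵥ : (c u w : Pt d) → dot c (u +ᵥ w) ≡ dot c u + dot c w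
  dot-+ᵥ [] [] [] = refl
  dot-+ᵥ (a ∷ c) (x ∷ u) (y ∷ w) =
    trans (cong (a * (x + y) +_) (dot-+ᵥ c u w)) (rearrange a x y (dot c u) (dot c w))
    where
    rearrange : ∀ a x y s t → a * (x + y) + (s + t) ≡ (a * x + s) + (a * y + t)
    rearrange = solve-∀
  dot-• : (c : Pt d) (m : ℤ) (u : Pt d) → dot c (m • u) ≡ m * dot c u
  dot-• [] m [] = sym (ℤP.*-zeroʳ m)
  dot-• (a ∷ c) m (x ∷ u) =
    trans (cong (a * (m * x) +_) (dot-• c m u)) (rearrange a m x (dot c u))
    where
    rearrange : ∀ a m x s → a * (m * x) + m * s ≡ m * (a * x + s)
    rearrange = solve-∀

linear-cancel : {φ ψ : Pt d → ℤ} (κ : ℤ) → κ ≢ 0ℤ → (∀ w → φ w * κ ≡ ψ w) → Linear ψ → Linear φ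
linear-cancel {φ = φ} {ψ} κ κ≢0 φκ≡ψ ψ-linear = record
  { +ᵥ-homo = λ u w → cancel (begin
      φ (u +ᵥ w) * κ      ≡⟨ φκ≡ψ (u +ᵥ w) ⟩
      ψ (u +ᵥ w)          ≡⟨ +ᵥ-homo u w ⟩
      ψ u + ψ w           ≡⟨ sym (cong₂ _+_ (φκ≡ψ u) (φκ≡ψ w)) ⟩
      φ u * κ + φ w * κ   ≡⟨ sym (ℤP.*-distribʳ-+ κ (φ u) (φ w)) ⟩
      (φ u + φ w) * κ     ∎)
  ; •-homo = λ m u → cancel (begin
      φ (m • u) * κ       ≡⟨ φκ≡ψ (m • u) ⟩
      ψ (m • u)           ≡⟨ •-homo m u ⟩
      m * ψ u             ≡⟨ cong (m *_) (sym (φκ≡ψ u)) ⟩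
      m * (φ u * κ)       ≡⟨ sym (ℤP.*-assoc m (φ u) κ) ⟩
      (m * φ u) * κ       ∎)
  }
  where
  open ≡-Reasoning
  open Linear ψ-linear
  cancel : ∀ {i j} → i * κ ≡ j * κ → i ≡ j
  cancel {i} {j} = ℤP.*-cancelʳ-≡ i j κ {{ℤ.≢-nonZero κ≢0}}

linear-expand₂ : {φ : Pt d → ℤ} → Linear φ → (q : Fin n → Pt d) {x y : Fin n} → x ≢ y →
                 (∀ k → k ≢ x → k ≢ y → φ (q k) ≡ 0ℤ) →
                 ∀ a → φ (lincomb n a q) ≡ a x * φ (q x) + a y * φ (q y)
linear-expand₂ {n = n} {φ} φ-linear q {x} {y} x≢y φq≡0 a = trans (lincomb-homo n a q)
  (sum-pair _ x y x≢y (λ k k≢x k≢y → trans (cong (a k *_) (φq≡0 k k≢x k≢y)) (ℤP.*-zeroʳ (a k))))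
  where open Linear φ-linear

det₂ : ℤ → ℤ → ℤ → ℤ → ℤ
det₂ a b c e = a * e - b * c

det₂-mul : ∀ m₁₁ m₁₂ m₂₁ m₂₂ a₁₁ a₁₂ a₂₁ a₂₂ →
           det₂ (a₁₁ * m₁₁ + a₂₁ * m₁₂) (a₁₂ * m₁₁ + a₂₂ * m₁₂)
                (a₁₁ * m₂₁ + a₂₁ * m₂₂) (a₁₂ * m₂₁ + a₂₂ * m₂₂)
           ≡ det₂ m₁₁ m₁₂ m₂₁ m₂₂ * det₂ a₁₁ a₁₂ a₂₁ a₂₂
det₂-mul = expanded
  where
  expanded : ∀ m₁₁ m₁₂ m₂₁ m₂₂ a₁₁ a₁₂ a₂₁ a₂₂ →
             (a₁₁ * m₁₁ + a₂₁ * m₁₂) * (a₁₂ * m₂₁ + a₂₂ * m₂₂)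
               - (a₁₂ * m₁₁ + a₂₂ * m₁₂) * (a₁₁ * m₂₁ + a₂₁ * m₂₂)
             ≡ (m₁₁ * m₂₂ - m₁₂ * m₂₁) * (a₁₁ * a₂₂ - a₁₂ * a₂₁)
  expanded = solve-∀

det₂-cong : ∀ {a b c e a′ b′ c′ e′} → a ≡ a′ → b ≡ b′ → c ≡ c′ → e ≡ e′ →
            det₂ a b c e ≡ det₂ a′ b′ c′ e′
det₂-cong refl refl refl refl = refl

-- e₁ and e₂ are integer combinations of q, so the identity matrix factors through the minor.
minor-unimodular : {φ ψ : Pt d → ℤ} → Linear φ → Linear ψ →
                   (q : Fin n → Pt d) → (∀ w → ∃ λ a → w ≡ lincomb n a q) →
                   {x y : Fin n} → x ≢ y → (∀ k → k ≢ x → k ≢ y → φ (q k) ≡ 0ℤ × ψ (q k) ≡ 0ℤ) →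
                   {e₁ e₂ : Pt d} → φ e₁ ≡ 1ℤ → ψ e₁ ≡ 0ℤ → φ e₂ ≡ 0ℤ → ψ e₂ ≡ 1ℤ →
                   ∣ det₂ (φ (q x)) (φ (q y)) (ψ (q x)) (ψ (q y)) ∣ ≡ 1
minor-unimodular {φ = φ} {ψ} φ-linear ψ-linear q spans {x} {y} x≢y off-plane {e₁} {e₂}
                 φe₁≡1 ψe₁≡0 φe₂≡0 ψe₂≡1 =
  ℕP.m*n≡1⇒m≡1 ∣ M ∣ ∣ A ∣ (trans (sym (ℤP.abs-* M A)) (cong ∣_∣ M*A≡1))
  where
  open ≡-Reasoning
  a₁ a₂ : Fin _ → ℤ
  a₁ = proj₁ (spans e₁)
  a₂ = proj₁ (spans e₂)
  M A : ℤ
  M = det₂ (φ (q x)) (φ (q y)) (ψ (q x)) (ψ (q y))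
  A = det₂ (a₁ x) (a₂ x) (a₁ y) (a₂ y)
  φ-expand : ∀ w → φ w ≡ proj₁ (spans w) x * φ (q x) + proj₁ (spans w) y * φ (q y)
  φ-expand w = trans (cong φ (proj₂ (spans w)))
    (linear-expand₂ φ-linear q x≢y (λ k k≢x k≢y → proj₁ (off-plane k k≢x k≢y)) (proj₁ (spans w)))
  ψ-expand : ∀ w → ψ w ≡ proj₁ (spans w) x * ψ (q x) + proj₁ (spans w) y * ψ (q y)
  ψ-expand w = trans (cong ψ (proj₂ (spans w)))
    (linear-expand₂ ψ-linear q x≢y (λ k k≢x k≢y → proj₂ (off-plane k k≢x k≢y)) (proj₁ (spans w)))
  M*A≡1 : M * A ≡ 1ℤ
  M*A≡1 = begin
    M * A
      ≡⟨ det₂-mul (φ (q x)) (φ (q y)) (ψ (q x)) (ψ (q y)) (a₁ x) (a₂ x) (a₁ y) (a₂ y) ⟨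
    det₂ (a₁ x * φ (q x) + a₁ y * φ (q y)) (a₂ x * φ (q x) + a₂ y * φ (q y))
         (a₁ x * ψ (q x) + a₁ y * ψ (q y)) (a₂ x * ψ (q x) + a₂ y * ψ (q y))
                                        ≡⟨ det₂-cong (φ-expand e₁) (φ-expand e₂) (ψ-expand e₁) (ψ-expand e₂) ⟨
    det₂ (φ e₁) (φ e₂) (ψ e₁) (ψ e₂)    ≡⟨ det₂-cong φe₁≡1 φe₂≡0 ψe₁≡0 ψe₂≡1 ⟩
    det₂ 1ℤ 0ℤ 0ℤ 1ℤ                    ≡⟨⟩
    1ℤ                                  ∎

_⊆ᶠ_ : CubeFace d → CubeFace d → Set
σ ⊆ᶠ τ = ∀ {e} → InFace σ e → InFace τ e

InFace-lookup : (σ : CubeFace d) {e : Label d} {k : Fin d} {a : Bool} →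
                InFace σ e → lookup σ k ≡ just a → lookup e k ≡ a
InFace-lookup (nothing ∷ σ) {b ∷ e} {zero} _ ()
InFace-lookup (just c ∷ σ) {b ∷ e} {zero} (c≡b , _) refl = sym c≡b
InFace-lookup (nothing ∷ σ) {b ∷ e} {suc k} e∈σ σk≡a = InFace-lookup σ e∈σ σk≡a
InFace-lookup (just c ∷ σ) {b ∷ e} {suc k} (_ , e∈σ) σk≡a = InFace-lookup σ e∈σ σk≡a

InFace-replicate : {e : Label d} → InFace (replicate d nothing) e
InFace-replicate {e = []} = tt
InFace-replicate {e = b ∷ e} = InFace-replicate {e = e}

InFace-[]≔ : (σ : CubeFace d) {e : Label d} {k : Fin d} {a : Bool} →
             lookup e k ≡ a → InFace σ e → InFace (σ [ k ]≔ just a) e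
InFace-[]≔ (nothing ∷ σ) {b ∷ e} {zero} refl e∈σ = refl , e∈σ
InFace-[]≔ (just c ∷ σ) {b ∷ e} {zero} refl (_ , e∈σ) = refl , e∈σ
InFace-[]≔ (nothing ∷ σ) {b ∷ e} {suc k} ek≡a e∈σ = InFace-[]≔ σ ek≡a e∈σ
InFace-[]≔ (just c ∷ σ) {b ∷ e} {suc k} ek≡a (c≡b , e∈σ) = c≡b , InFace-[]≔ σ ek≡a e∈σ

∈F1 : (x : Fin d) {a : Bool} {e : Label d} → lookup e x ≡ a → InFace (F1 x a) e
∈F1 {d} x {a} {e} ex≡a = InFace-[]≔ (replicate d nothing) {e} {x} ex≡a (InFace-replicate {e = e})

∈F1⁻ : (x : Fin d) {a : Bool} {e : Label d} → InFace (F1 x a) e → lookup e x ≡ a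
∈F1⁻ {d} x {a} e∈F = InFace-lookup (F1 x a) e∈F (VecP.lookup∘update x (replicate d nothing) (just a))

∉F1 : (x : Fin d) {a : Bool} {e : Label d} → lookup e x ≡ not a → ¬ InFace (F1 x a) e
∉F1 x ex≡¬a e∈F = not-¬ (∈F1⁻ x e∈F) ex≡¬a

∈F2 : (x y : Fin d) {a b : Bool} {e : Label d} → lookup e x ≡ a → lookup e y ≡ b → InFace (F2 x a y b) e
∈F2 x y {a} {e = e} ex≡a ey≡b = InFace-[]≔ (F1 x a) {e} {y} ey≡b (∈F1 x ex≡a)

F2⊆F1ˡ : {x y : Fin d} {a b : Bool} → x ≢ y → F2 x a y b ⊆ᶠ F1 x a
F2⊆F1ˡ {x = x} {y} {a} {b} x≢y {e} e∈F = ∈F1 x (InFace-lookup (F2 x a y b) e∈F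
  (trans (VecP.lookup∘update′ x≢y (F1 x a) (just b)) (VecP.lookup∘update x (replicate _ nothing) (just a))))

F2⊆F1ʳ : (x y : Fin d) {a b : Bool} → F2 x a y b ⊆ᶠ F1 y b
F2⊆F1ʳ x y {a} {b} {e} e∈F = ∈F1 y (InFace-lookup (F2 x a y b) e∈F (VecP.lookup∘update y (F1 x a) (just b)))

F2-comm : {x y : Fin d} {a b : Bool} → x ≢ y → F2 x a y b ≡ F2 y b x a
F2-comm {x = x} {y} x≢y = VecP.[]≔-commutes (replicate _ nothing) x y x≢y

lookup-flip : (e : Label d) (k : Fin d) → lookup (flip e k) k ≡ not (lookup e k)
lookup-flip (b ∷ e) zero = refl
lookup-flip (b ∷ e) (suc k) = lookup-flip e k

lookup-flip-≢ : (e : Label d) {k j : Fin d} → k ≢ j → lookup (flip e k) j ≡ lookup e j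
lookup-flip-≢ (b ∷ e) {zero} {zero} k≢j = contradiction refl k≢j
lookup-flip-≢ (b ∷ e) {zero} {suc j} _ = refl
lookup-flip-≢ (b ∷ e) {suc k} {zero} _ = refl
lookup-flip-≢ (b ∷ e) {suc k} {suc j} k≢j = lookup-flip-≢ e (k≢j ∘ cong suc)

flip-involutive : (e : Label d) (k : Fin d) → flip (flip e k) k ≡ e
flip-involutive (false ∷ e) zero = refl
flip-involutive (true ∷ e) zero = refl
flip-involutive (b ∷ e) (suc k) = cong (b ∷_) (flip-involutive e k)

flip-comm : (e : Label d) (j k : Fin d) → flip (flip e j) k ≡ flip (flip e k) j
flip-comm (b ∷ e) zero zero = refl
flip-comm (b ∷ e) zero (suc k) = refl
flip-comm (b ∷ e) (suc j) zero = refl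
flip-comm (b ∷ e) (suc j) (suc k) = cong (b ∷_) (flip-comm e j k)

module DirectionSpace {d : ℕ} (v : Vertices d) where

  combination : (Label d → Label d → ℤ) → Pt d
  combination c = pairSum (allLabels d) (allLabels d) (λ e e′ → c e e′ • (v e -ᵥ v e′))

  Supported : CubeFace d → (Label d → Label d → ℤ) → Set
  Supported σ c = ∀ e e′ → c e e′ ≢ 0ℤ → InFace σ e × InFace σ e′

  -- InDirSpace, repackaged as records so that the face can be inferred from the type.
  record InSpan (σ : CubeFace d) (u : Pt d) : Set where
    constructor span
    field
      coeff      : Label d → Label d → ℤ
      supported  : Supported σ coeff
      expansion  : u ≡ combination coeff

  record Dir (σ : CubeFace d) (w : Pt d) : Set where
    constructor dir
    field
      scale      : ℤ
      scale≢0    : scale ≢ 0ℤ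
      scaled∈    : InSpan σ (scale • w)

  Dir⇒InDirSpace : ∀ {σ w} → Dir σ w → InDirSpace v σ w
  Dir⇒InDirSpace (dir m m≢0 (span c supp mw≡)) = m , m≢0 , c , supp , mw≡

  InDirSpace⇒Dir : ∀ {σ w} → InDirSpace v σ w → Dir σ w
  InDirSpace⇒Dir (m , m≢0 , c , supp , mw≡) = dir m m≢0 (span c supp mw≡)

  private
    L : List (Label d)
    L = allLabels d

  module _ {σ : CubeFace d} where

    span-0ᵥ : InSpan σ 0ᵥ
    span-0ᵥ = span (λ _ _ → 0ℤ) (λ _ _ 0≢0 → contradiction refl 0≢0)
      (sym (trans (pairSum-• 0ℤ L L (λ e e′ → v e -ᵥ v e′)) (•-zeroˡ _)))

    span-+ᵥ : ∀ {u w} → InSpan σ u → InSpan σ w → InSpan σ (u +ᵥ w)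
    span-+ᵥ (span c₁ supp₁ u≡) (span c₂ supp₂ w≡) = span (λ e e′ → c₁ e e′ + c₂ e e′) supp
      (trans (cong₂ _+ᵥ_ u≡ w≡) (sym (trans
        (pairSum-cong L L (λ e e′ → •-distribʳ (c₁ e e′) (c₂ e e′) (v e -ᵥ v e′)))
        (pairSum-+ᵥ L L _ _))))
      where
      supp : Supported σ (λ e e′ → c₁ e e′ + c₂ e e′)
      supp e e′ sum≢0 with c₁ e e′ ℤ.≟ 0ℤ
      ... | no c₁≢0 = supp₁ e e′ c₁≢0
      ... | yes c₁≡0 = supp₂ e e′ (λ c₂≡0 → sum≢0 (cong₂ _+_ c₁≡0 c₂≡0))

    span-• : ∀ m {u} → InSpan σ u → InSpan σ (m • u)
    span-• m (span c supp u≡) = span (λ e e′ → m * c e e′)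
      (λ e e′ mc≢0 → supp e e′ (λ c≡0 → mc≢0 (trans (cong (m *_) c≡0) (ℤP.*-zeroʳ m))))
      (trans (cong (m •_) u≡) (sym (trans
        (pairSum-cong L L (λ e e′ → •-assoc m (c e e′) (v e -ᵥ v e′)))
        (pairSum-• m L L _))))

    span-edge : ∀ {e₀ e₀′} → InFace σ e₀ → InFace σ e₀′ → InSpan σ (v e₀ -ᵥ v e₀′)
    span-edge {e₀} {e₀′} e₀∈σ e₀′∈σ = span c supp
      (sym (trans (pairSum-allLabels-single _ e₀ e₀′ off-diagonal)
                  (trans (cong (_• (v e₀ -ᵥ v e₀′)) (δ-yes (refl , refl) (is-diagonal e₀ e₀′)))
                         (•-identityˡ _))))
      where
      is-diagonal : ∀ e e′ → Dec (e ≡ e₀ × e′ ≡ e₀′)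
      is-diagonal e e′ = VecP.≡-dec Data.Bool._≟_ e e₀ ×-dec VecP.≡-dec Data.Bool._≟_ e′ e₀′
      δ : ∀ {P : Set} → Dec P → ℤ
      δ (yes _) = 1ℤ
      δ (no _) = 0ℤ
      δ-yes : ∀ {P : Set} → P → (P? : Dec P) → δ P? ≡ 1ℤ
      δ-yes p (yes _) = refl
      δ-yes p (no ¬p) = contradiction p ¬p
      c : Label d → Label d → ℤ
      c e e′ = δ (is-diagonal e e′)
      supp : Supported σ c
      supp e e′ c≢0 with is-diagonal e e′
      ... | yes (refl , refl) = e₀∈σ , e₀′∈σ
      ... | no _ = contradiction refl c≢0
      off-diagonal : ∀ e e′ → ¬ (e ≡ e₀ × e′ ≡ e₀′) → c e e′ • (v e -ᵥ v e′) ≡ 0ᵥ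
      off-diagonal e e′ ¬diag with is-diagonal e e′
      ... | yes diag = contradiction diag ¬diag
      ... | no _ = •-zeroˡ _

    span-ind : (P : Pt d → Set) → P 0ᵥ → (∀ {u w} → P u → P w → P (u +ᵥ w)) →
               (∀ m {u} → P u → P (m • u)) →
               (∀ {e e′} → InFace σ e → InFace σ e′ → P (v e -ᵥ v e′)) → ∀ {u} → InSpan σ u → P u
    span-ind P P0 P+ P• Pedge (span c supp u≡) = subst P (sym u≡) (pairSum-closed P P0 P+ L L _ term)
      where
      term : ∀ e e′ → P (c e e′ • (v e -ᵥ v e′))
      term e e′ with c e e′ ℤ.≟ 0ℤ
      ... | yes c≡0 = subst P (sym (trans (cong (_• (v e -ᵥ v e′)) c≡0) (•-zeroˡ _))) P0
      ... | no c≢0 = P• (c e e′) (Pedge (proj₁ (supp e e′ c≢0)) (proj₂ (supp e e′ c≢0)))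

    dir-0ᵥ : Dir σ 0ᵥ
    dir-0ᵥ = dir 1ℤ (λ ()) (subst (InSpan σ) (sym (•-identityˡ 0ᵥ)) span-0ᵥ)

    dir-+ᵥ : ∀ {u w} → Dir σ u → Dir σ w → Dir σ (u +ᵥ w)
    dir-+ᵥ {u} {w} (dir m m≢0 mu∈) (dir n n≢0 nw∈) =
      dir (m * n) (i*j≢0 m≢0 n≢0) (subst (InSpan σ) (sym common-scale) (span-+ᵥ (span-• n mu∈) (span-• m nw∈)))
      where
      open ≡-Reasoning
      common-scale : (m * n) • (u +ᵥ w) ≡ (n • (m • u)) +ᵥ (m • (n • w))
      common-scale = begin
        (m * n) • (u +ᵥ w)                 ≡⟨ •-distribˡ (m * n) u w ⟩
        ((m * n) • u) +ᵥ ((m * n) • w)     ≡⟨ cong (λ k → (k • u) +ᵥ ((m * n) • w)) (ℤP.*-comm m n) ⟩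
        ((n * m) • u) +ᵥ ((m * n) • w)     ≡⟨ cong₂ _+ᵥ_ (•-assoc n m u) (•-assoc m n w) ⟩
        (n • (m • u)) +ᵥ (m • (n • w))     ∎

    dir-• : ∀ n {u} → Dir σ u → Dir σ (n • u)
    dir-• n {u} (dir m m≢0 mu∈) = dir m m≢0 (subst (InSpan σ) (•-comm n m u) (span-• n mu∈))

    dir-cancel : ∀ {n u} → n ≢ 0ℤ → Dir σ (n • u) → Dir σ u
    dir-cancel {n} {u} n≢0 (dir m m≢0 mnu∈) =
      dir (m * n) (i*j≢0 m≢0 n≢0) (subst (InSpan σ) (sym (•-assoc m n u)) mnu∈)

    dir--ᵥ : ∀ {u w} → Dir σ u → Dir σ w → Dir σ (u -ᵥ w)
    dir--ᵥ {u} {w} u∈ w∈ = subst (Dir σ) (sym (-ᵥ-as-+ᵥ u w)) (dir-+ᵥ u∈ (dir-• -1ℤ w∈))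

    dir-edge : ∀ {e e′} → InFace σ e → InFace σ e′ → Dir σ (v e -ᵥ v e′)
    dir-edge e∈σ e′∈σ = dir 1ℤ (λ ()) (subst (InSpan σ) (sym (•-identityˡ _)) (span-edge e∈σ e′∈σ))

    dir-mono : ∀ {τ w} → σ ⊆ᶠ τ → Dir σ w → Dir τ w
    dir-mono σ⊆τ (dir m m≢0 (span c supp mw≡)) =
      dir m m≢0 (span c (λ e e′ c≢0 → σ⊆τ (proj₁ (supp e e′ c≢0)) , σ⊆τ (proj₂ (supp e e′ c≢0))) mw≡)

  dir-⊆ : ∀ {σ τ w} → (∀ {e e′} → InFace σ e → InFace σ e′ → Dir τ (v e -ᵥ v e′)) → Dir σ w → Dir τ w
  dir-⊆ {τ = τ} edges⊆τ (dir m m≢0 mw∈) = dir-cancel m≢0 (span-ind (Dir τ) dir-0ᵥ dir-+ᵥ dir-• edges⊆τ mw∈)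

  linear-⊥-dir : ∀ {σ φ w} → Linear φ →
                 (∀ {e e′} → InFace σ e → InFace σ e′ → φ (v e -ᵥ v e′) ≡ 0ℤ) →
                 Dir σ w → φ w ≡ 0ℤ
  linear-⊥-dir {φ = φ} {w} φ-linear φ⊥edges (dir m m≢0 mw∈) =
    i*j≡0⇒j≡0 m≢0 (trans (sym (•-homo m w)) (span-ind (λ u → φ u ≡ 0ℤ) 0ᵥ-homo
      (λ φu≡0 φw≡0 → trans (+ᵥ-homo _ _) (cong₂ _+_ φu≡0 φw≡0))
      (λ n φu≡0 → trans (•-homo n _) (trans (cong (n *_) φu≡0) (ℤP.*-zeroʳ n)))
      φ⊥edges mw∈))
    where open Linear φ-linear

  Parallel⇒dir : ∀ {σ τ w} → Parallel v σ τ → Dir σ w → Dir τ w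
  Parallel⇒dir σ∥τ = dir-⊆ (λ e∈σ e′∈σ → InDirSpace⇒Dir (proj₁ σ∥τ _ _ e∈σ e′∈σ))

  dir⇒Parallel : ∀ {σ τ} → (∀ {w} → Dir σ w → Dir τ w) → (∀ {w} → Dir τ w → Dir σ w) → Parallel v σ τ
  dir⇒Parallel σ⊆τ τ⊆σ = (λ _ _ e∈σ e′∈σ → Dir⇒InDirSpace (σ⊆τ (dir-edge e∈σ e′∈σ)))
                       , (λ _ _ e∈τ e′∈τ → Dir⇒InDirSpace (τ⊆σ (dir-edge e∈τ e′∈τ)))

module Coordinates {d : ℕ} (v : Vertices d) (comb : IsCombCube v) (smooth : IsSmooth v) where
  open DirectionSpace v

  normal : CubeFace d → Pt d
  normal σ = proj₁ (proj₁ comb σ)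

  normal-max : ∀ {σ e} → InFace σ e → IsMax v (normal σ) e
  normal-max {σ} {e} = proj₂ (proj₂ (proj₁ comb σ) e)

  normal-max⁻ : ∀ {σ e} → IsMax v (normal σ) e → InFace σ e
  normal-max⁻ {σ} {e} = proj₁ (proj₂ (proj₁ comb σ) e)

  normal-⊥ : ∀ {σ w} → Dir σ w → dot (normal σ) w ≡ 0ℤ
  normal-⊥ {σ} = linear-⊥-dir (dot-linear (normal σ)) λ {e} {e′} e∈σ e′∈σ →
    trans (-ᵥ-homo (v e) (v e′)) (ℤP.i≡j⇒i-j≡0 (ℤP.≤-antisym (normal-max e′∈σ e) (normal-max e∈σ e′)))
    where open Linear (dot-linear (normal σ))

  private
    normal-strict : ∀ {σ e e′} → InFace σ e → ¬ InFace σ e′ → dot (normal σ) (v e′) <ℤ dot (normal σ) (v e)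
    normal-strict {σ} e∈σ e′∉σ = ℤP.≤∧≢⇒< (normal-max e∈σ _) λ same → e′∉σ (normal-max⁻ λ ε →
      subst (dot (normal σ) (v ε) ≤ℤ_) (sym same) (normal-max e∈σ ε))

  normal-drops : ∀ {σ e e′} → InFace σ e → ¬ InFace σ e′ → dot (normal σ) (v e′ -ᵥ v e) <ℤ 0ℤ
  normal-drops {σ} {e} {e′} e∈σ e′∉σ =
    subst (_<ℤ 0ℤ) (sym (-ᵥ-homo (v e′) (v e))) (i<j⇒i-j<0 (normal-strict e∈σ e′∉σ))
    where open Linear (dot-linear (normal σ))

  normal-rises : ∀ {σ e e′} → InFace σ e → ¬ InFace σ e′ → 0ℤ <ℤ dot (normal σ) (v e -ᵥ v e′)
  normal-rises {σ} {e} {e′} e∈σ e′∉σ =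
    subst (0ℤ <ℤ_) (sym (-ᵥ-homo (v e) (v e′))) (i<j⇒0<j-i (normal-strict e∈σ e′∉σ))
    where open Linear (dot-linear (normal σ))

  basis : Label d → Fin d → Pt d
  basis η = proj₁ (smooth η)

  edgeScale : Label d → Fin d → ℕ
  edgeScale η k = proj₁ (proj₂ (proj₁ (proj₂ (smooth η)) k))

  edge≡ : ∀ η k → v (flip η k) -ᵥ v η ≡ +[1+ edgeScale η k ] • basis η k
  edge≡ η k = proj₂ (proj₂ (proj₁ (proj₂ (smooth η)) k))

  basis-spans : ∀ η w → ∃ λ a → w ≡ lincomb d a (basis η)
  basis-spans η = proj₁ (proj₂ (proj₂ (smooth η)))

  basis-dir : ∀ {τ η k} → InFace τ η → InFace τ (flip η k) → Dir τ (basis η k)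
  basis-dir {η = η} {k} η∈τ flipη∈τ =
    dir-cancel {n = +[1+ edgeScale η k ]} (λ ()) (subst (Dir _) (edge≡ η k) (dir-edge flipη∈τ η∈τ))

  o : Label d
  o = replicate d false

  lookup-o : ∀ k → lookup o k ≡ false
  lookup-o k = VecP.lookup-replicate k false

  o∈F : ∀ z → InFace (F1 z false) o
  o∈F z = ∈F1 z (lookup-o z)

  flip-o∈F : ∀ {z k} → k ≢ z → InFace (F1 z false) (flip o k)
  flip-o∈F {z} k≢z = ∈F1 z (trans (lookup-flip-≢ o k≢z) (lookup-o z))

  flip-o∉F : ∀ z → ¬ InFace (F1 z false) (flip o z)
  flip-o∉F z = ∉F1 z (trans (lookup-flip o z) (cong not (lookup-o z)))

  coord : Fin d → Pt d → ℤ
  coord z w = proj₁ (basis-spans o w) z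

  κ : Fin d → ℤ
  κ z = dot (normal (F1 z false)) (basis o z)

  coord-normal : ∀ z w → coord z w * κ z ≡ dot (normal (F1 z false)) w
  coord-normal z w = sym (begin
    dot ν w                             ≡⟨ cong (dot ν) (proj₂ (basis-spans o w)) ⟩
    dot ν (lincomb d a (basis o))       ≡⟨ lincomb-homo d a (basis o) ⟩
    ∑[ k < d ] (a k * dot ν (basis o k)) ≡⟨ sum-single _ z off-z ⟩
    a z * κ z                           ∎)
    where
    open ≡-Reasoning
    ν : Pt d
    ν = normal (F1 z false)
    a : Fin d → ℤ
    a = proj₁ (basis-spans o w)
    open Linear (dot-linear ν)
    off-z : ∀ k → k ≢ z → a k * dot ν (basis o k) ≡ 0ℤ
    off-z k k≢z = trans (cong (a k *_) (normal-⊥ (basis-dir (o∈F z) (flip-o∈F k≢z)))) (ℤP.*-zeroʳ (a k))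

  κ<0 : ∀ z → κ z <ℤ 0ℤ
  κ<0 z = +[1+m]*i<0⇒i<0 (edgeScale o z) (subst (_<ℤ 0ℤ) scaled (normal-drops (o∈F z) (flip-o∉F z)))
    where
    open Linear (dot-linear (normal (F1 z false)))
    scaled : dot (normal (F1 z false)) (v (flip o z) -ᵥ v o) ≡ +[1+ edgeScale o z ] * κ z
    scaled = trans (cong (dot (normal (F1 z false))) (edge≡ o z)) (•-homo +[1+ edgeScale o z ] (basis o z))

  κ≢0 : ∀ z → κ z ≢ 0ℤ
  κ≢0 z = ℤP.<⇒≢ (κ<0 z)

  -- coord reads off the expansion chosen by basis-spans;
  -- coord-normal expresses it through the normal of F_z, which makes it linear.
  coord-linear : ∀ z → Linear (coord z)
  coord-linear z = linear-cancel (κ z) (κ≢0 z) (coord-normal z) (dot-linear (normal (F1 z false)))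

  dir-F1⇒coord≡0 : ∀ {z w} → Dir (F1 z false) w → coord z w ≡ 0ℤ
  dir-F1⇒coord≡0 {z} {w} w∈ = i*j≡0⇒i≡0 (κ≢0 z) (trans (coord-normal z w) (normal-⊥ w∈))

  coord-basis : ∀ z → coord z (basis o z) ≡ 1ℤ
  coord-basis z = ℤP.*-cancelʳ-≡ _ _ (κ z) {{ℤ.≢-nonZero (κ≢0 z)}}
    (trans (coord-normal z (basis o z)) (sym (ℤP.*-identityˡ (κ z))))

  coord-basis-≢ : ∀ {z k} → k ≢ z → coord z (basis o k) ≡ 0ℤ
  coord-basis-≢ {z} k≢z = dir-F1⇒coord≡0 (basis-dir (o∈F z) (flip-o∈F k≢z))

  coord-edge : ∀ z → coord z (v (flip o z) -ᵥ v o) ≡ +[1+ edgeScale o z ]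
  coord-edge z = begin
    coord z (v (flip o z) -ᵥ v o)             ≡⟨ cong (coord z) (edge≡ o z) ⟩
    coord z (+[1+ edgeScale o z ] • basis o z) ≡⟨ •-homo +[1+ edgeScale o z ] (basis o z) ⟩
    +[1+ edgeScale o z ] * coord z (basis o z) ≡⟨ cong (+[1+ edgeScale o z ] *_) (coord-basis z) ⟩
    +[1+ edgeScale o z ] * 1ℤ                  ≡⟨ ℤP.*-identityʳ _ ⟩
    +[1+ edgeScale o z ]                       ∎
    where
    open ≡-Reasoning
    open Linear (coord-linear z)

  coord-leaves : ∀ {z e e′} → InFace (F1 z false) e → ¬ InFace (F1 z false) e′ → 0ℤ <ℤ coord z (v e′ -ᵥ v e)
  coord-leaves {z} e∈F e′∉F =
    i*j<0∧j<0⇒0<i (subst (_<ℤ 0ℤ) (sym (coord-normal z _)) (normal-drops e∈F e′∉F)) (κ<0 z)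

  dir-from-coords : ∀ {τ w} → InFace τ o → (∀ k → coord k w ≡ 0ℤ ⊎ InFace τ (flip o k)) → Dir τ w
  dir-from-coords {τ} {w} o∈τ free = subst (Dir τ) (sym (proj₂ (basis-spans o w)))
    (lincomb-closed (Dir τ) dir-0ᵥ dir-+ᵥ d _ (basis o) term)
    where
    term : ∀ k → Dir τ (coord k w • basis o k)
    term k with free k
    ... | inj₁ wk≡0 = subst (Dir τ) (sym (trans (cong (_• basis o k) wk≡0) (•-zeroˡ _))) dir-0ᵥ
    ... | inj₂ flipo∈τ = dir-• (coord k w) (basis-dir o∈τ flipo∈τ)

  coord≡0⇒dir-F1 : ∀ {z w} → coord z w ≡ 0ℤ → Dir (F1 z false) w
  coord≡0⇒dir-F1 {z} {w} wz≡0 = dir-from-coords (o∈F z) free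
    where
    free : ∀ k → coord k w ≡ 0ℤ ⊎ InFace (F1 z false) (flip o k)
    free k with k Fin.≟ z
    ... | yes refl = inj₁ wz≡0
    ... | no k≢z = inj₂ (flip-o∈F k≢z)

private
  steep-positive-slope : ∀ j a K j′ → +[1+ j ] * +[1+ a ] + +[1+ K ] ≡ +[1+ j′ ] → ℕ.suc j ℕ.< ℕ.suc j′
  steep-positive-slope j a K j′ eq = subst (ℕ.suc j ℕ.<_) (ℤP.+-injective eq)
    (ℕP.≤-<-trans (ℕP.m≤m*n (ℕ.suc j) (ℕ.suc a)) (ℕP.m<m+n _ ℕ.z<s))

  negative-slope : ∀ a K L → 0ℤ <ℤ +[1+ K ] + -[1+ a ] * +[1+ L ] → 0ℤ <ℤ +[1+ K ] - +[1+ L ]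
  negative-slope a K L 0<c = ℤP.<-≤-trans 0<c (ℤP.+-monoʳ-≤ +[1+ K ] (ℤ.-≤- (ℕP.m≤m+n L _)))

-- The quadrilateral has vertices 0, (K+1, 0), (0, L+1) and a fourth vertex reached from
-- these two by (j+1)(α, 1) and (j′+1)(1, β); the inequalities say that each of (K+1, 0) and
-- (0, L+1) lies strictly inside the half-plane bounded by the side through the other one.
quadrilateral-slope≡0 : ∀ (j j′ K L : ℕ) (α β : ℤ) → ∣ 1ℤ - α * β ∣ ≡ 1 →
                        +[1+ j ] * α + +[1+ K ] ≡ +[1+ j′ ] → +[1+ j′ ] * β + +[1+ L ] ≡ +[1+ j ] →
                        0ℤ <ℤ +[1+ K ] + α * +[1+ L ] → 0ℤ <ℤ +[1+ L ] + β * +[1+ K ] →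
                        α ≡ 0ℤ ⊎ β ≡ 0ℤ
quadrilateral-slope≡0 j j′ K L +0 β _ _ _ _ _ = inj₁ refl
quadrilateral-slope≡0 j j′ K L α +0 _ _ _ _ _ = inj₂ refl
quadrilateral-slope≡0 j j′ K L +[1+ a ] +[1+ b ] _ x-closes y-closes _ _ =
  contradiction (steep-positive-slope j′ b L j y-closes) (ℕP.<-asym (steep-positive-slope j a K j′ x-closes))
quadrilateral-slope≡0 j j′ K L -[1+ a ] -[1+ b ] _ _ _ x-convex y-convex =
  ⊥-elim (ℤP.<-irrefl (cancels +[1+ K ] +[1+ L ])
    (ℤP.+-mono-< (negative-slope a K L x-convex) (negative-slope b L K y-convex)))
  where
  cancels : ∀ k l → 0ℤ ≡ (k - l) + (l - k)
  cancels = solve-∀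
quadrilateral-slope≡0 j j′ K L +[1+ a ] -[1+ b ] () _ _ _ _
quadrilateral-slope≡0 j j′ K L -[1+ a ] +[1+ b ] () _ _ _ _

-- The 2-face through o in the directions x and y

module Corner {d : ℕ} (v : Vertices d) (comb : IsCombCube v) (smooth : IsSmooth v)
  (x y : Fin d) (x≢y : x ≢ y) (par : ∀ a b a′ b′ → Parallel v (F2 x a y b) (F2 x a′ y b′)) where

  open DirectionSpace v
  open Coordinates v comb smooth

  q₁₀ q₀₁ far : Label d
  q₁₀ = flip o x
  q₀₁ = flip o y
  far = flip q₁₀ y

  q₁₀-x : lookup q₁₀ x ≡ true
  q₁₀-x = trans (lookup-flip o x) (cong not (lookup-o x))

  q₁₀-y : lookup q₁₀ y ≡ false
  q₁₀-y = trans (lookup-flip-≢ o x≢y) (lookup-o y)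

  q₀₁-x : lookup q₀₁ x ≡ false
  q₀₁-x = trans (lookup-flip-≢ o (≢-sym x≢y)) (lookup-o x)

  far-x : lookup far x ≡ true
  far-x = trans (lookup-flip-≢ q₁₀ (≢-sym x≢y)) q₁₀-x

  far-y : lookup far y ≡ true
  far-y = trans (lookup-flip q₁₀ y) (cong not q₁₀-y)

  dir-F2⇒coord≡0 : ∀ {a b w} → Dir (F2 x a y b) w → coord x w ≡ 0ℤ × coord y w ≡ 0ℤ
  dir-F2⇒coord≡0 {a} {b} {w} w∈ =
    dir-F1⇒coord≡0 (dir-mono (F2⊆F1ˡ x≢y) w∈₀) , dir-F1⇒coord≡0 (dir-mono (F2⊆F1ʳ x y) w∈₀)
    where
    w∈₀ : Dir (F2 x false y false) w
    w∈₀ = Parallel⇒dir (par a b false false) w∈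

  coord≡0⇒dir-F2 : ∀ {a b w} → coord x w ≡ 0ℤ → coord y w ≡ 0ℤ → Dir (F2 x a y b) w
  coord≡0⇒dir-F2 {a} {b} {w} wx≡0 wy≡0 =
    Parallel⇒dir (par false false a b) (dir-from-coords {τ = F2 x false y false} (∈F2 x y (lookup-o x) (lookup-o y)) free)
    where
    free : ∀ k → coord k w ≡ 0ℤ ⊎ InFace (F2 x false y false) (flip o k)
    free k with k Fin.≟ x | k Fin.≟ y
    ... | yes refl | _ = inj₁ wx≡0
    ... | no _ | yes refl = inj₁ wy≡0
    ... | no k≢x | no k≢y =
      inj₂ (∈F2 x y (trans (lookup-flip-≢ o k≢x) (lookup-o x)) (trans (lookup-flip-≢ o k≢y) (lookup-o y)))

  basis-off-plane : ∀ η k → k ≢ x → k ≢ y → coord x (basis η k) ≡ 0ℤ × coord y (basis η k) ≡ 0ℤ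
  basis-off-plane η k k≢x k≢y = dir-F2⇒coord≡0 {lookup η x} {lookup η y}
    (basis-dir (∈F2 x y refl refl) (∈F2 x y (lookup-flip-≢ η k≢x) (lookup-flip-≢ η k≢y)))

  minor : Label d → ℤ
  minor η = det₂ (coord x (basis η x)) (coord x (basis η y)) (coord y (basis η x)) (coord y (basis η y))

  minor-unimodular-at : ∀ η → ∣ minor η ∣ ≡ 1
  minor-unimodular-at η = minor-unimodular (coord-linear x) (coord-linear y) (basis η) (basis-spans η) x≢y
    (basis-off-plane η) (coord-basis x) (coord-basis-≢ x≢y) (coord-basis-≢ (≢-sym x≢y)) (coord-basis y)

  u : Pt d
  u = basis q₁₀ y

  j : ℕ
  j = edgeScale q₁₀ y

  α : ℤ
  α = coord x u

  rise : ∀ z → coord z (v far -ᵥ v q₁₀) ≡ +[1+ j ] * coord z u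
  rise z = trans (cong (coord z) (edge≡ q₁₀ y)) (•-homo +[1+ j ] u)
    where open Linear (coord-linear z)

  coord-y-u≡1 : coord y u ≡ 1ℤ
  coord-y-u≡1 = ∣i∣≡1∧0<i⇒i≡1 unit positive
    where
    back-edge-vertical : coord y (basis q₁₀ x) ≡ 0ℤ
    back-edge-vertical =
      dir-F1⇒coord≡0 (basis-dir (∈F1 y q₁₀-y) (∈F1 y (trans (lookup-flip-≢ q₁₀ x≢y) q₁₀-y)))
    triangular : minor q₁₀ ≡ coord x (basis q₁₀ x) * coord y u
    triangular = trans (cong (λ c → coord x (basis q₁₀ x) * coord y u - α * c) back-edge-vertical)
                       (drop-zero (coord x (basis q₁₀ x) * coord y u) α)
      where
      drop-zero : ∀ p q → p - q * 0ℤ ≡ p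
      drop-zero = solve-∀
    unit : ∣ coord y u ∣ ≡ 1
    unit = ℕP.m*n≡1⇒n≡1 ∣ coord x (basis q₁₀ x) ∣ ∣ coord y u ∣
      (trans (sym (ℤP.abs-* (coord x (basis q₁₀ x)) (coord y u)))
             (trans (cong ∣_∣ (sym triangular)) (minor-unimodular-at q₁₀)))
    positive : 0ℤ <ℤ coord y u
    positive = 0<+[1+m]*i⇒0<i j (subst (0ℤ <ℤ_) (rise y)
      (coord-leaves (∈F1 y q₁₀-y) (∉F1 y far-y)))

  rise-y : coord y (v far -ᵥ v q₁₀) ≡ +[1+ j ]
  rise-y = trans (rise y) (trans (cong (+[1+ j ] *_) coord-y-u≡1) (ℤP.*-identityʳ +[1+ j ]))

  q₁₀-coord-y : coord y (v q₁₀ -ᵥ v o) ≡ 0ℤ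
  q₁₀-coord-y = dir-F1⇒coord≡0 (dir-edge (flip-o∈F x≢y) (o∈F y))

  q₀₁-coord-x : coord x (v q₀₁ -ᵥ v o) ≡ 0ℤ
  q₀₁-coord-x = dir-F1⇒coord≡0 (dir-edge (flip-o∈F (≢-sym x≢y)) (o∈F x))

  far-coord-x : coord x (v far -ᵥ v o) ≡ +[1+ j ] * α + +[1+ edgeScale o x ]
  far-coord-x = trans (-ᵥ-telescope (v far) (v q₁₀) (v o)) (cong₂ _+_ (rise x) (coord-edge x))
    where open Linear (coord-linear x)

  far-coord-y : coord y (v far -ᵥ v o) ≡ +[1+ j ]
  far-coord-y = begin
    coord y (v far -ᵥ v o)                          ≡⟨ -ᵥ-telescope (v far) (v q₁₀) (v o) ⟩
    coord y (v far -ᵥ v q₁₀) + coord y (v q₁₀ -ᵥ v o) ≡⟨ cong₂ _+_ rise-y q₁₀-coord-y ⟩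
    +[1+ j ] + 0ℤ                                   ≡⟨ ℤP.+-identityʳ +[1+ j ] ⟩
    +[1+ j ]                                        ∎
    where
    open ≡-Reasoning
    open Linear (coord-linear y)

  return-slope : coord x (basis far y) ≡ α * coord y (basis far y)
  return-slope = ℤP.*-cancelˡ-≡ +[1+ m ] _ _ (begin
    +[1+ m ] * coord x (basis far y)        ≡⟨ back-edge x ⟩
    - +[1+ j ] * α                          ≡⟨ cong (_* α) back-edge-y ⟨
    (+[1+ m ] * coord y (basis far y)) * α  ≡⟨ rearrange +[1+ m ] (coord y (basis far y)) α ⟩
    +[1+ m ] * (α * coord y (basis far y))  ∎)
    where
    open ≡-Reasoning
    m : ℕ
    m = edgeScale far y
    rearrange : ∀ a b c → (a * b) * c ≡ a * (c * b)
    rearrange = solve-∀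
    back-edge : ∀ z → +[1+ m ] * coord z (basis far y) ≡ - +[1+ j ] * coord z u
    back-edge z = begin
      +[1+ m ] * coord z (basis far y)   ≡⟨ •-homo +[1+ m ] (basis far y) ⟨
      coord z (+[1+ m ] • basis far y)   ≡⟨ cong (coord z) (edge≡ far y) ⟨
      coord z (v (flip far y) -ᵥ v far)  ≡⟨ cong (λ η → coord z (v η -ᵥ v far)) (flip-involutive q₁₀ y) ⟩
      coord z (v q₁₀ -ᵥ v far)           ≡⟨ -ᵥ-antisym (v far) (v q₁₀) ⟩
      - coord z (v far -ᵥ v q₁₀)         ≡⟨ cong -_ (rise z) ⟩
      - (+[1+ j ] * coord z u)           ≡⟨ ℤP.neg-distribˡ-* +[1+ j ] (coord z u) ⟩
      - +[1+ j ] * coord z u             ∎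
      where open Linear (coord-linear z)
    back-edge-y : +[1+ m ] * coord y (basis far y) ≡ - +[1+ j ]
    back-edge-y = trans (back-edge y) (trans (cong (- +[1+ j ] *_) coord-y-u≡1) (ℤP.*-identityʳ (- +[1+ j ])))

  f : Pt d
  f = normal (F1 x true)

  A : ℤ
  A = dot f (basis o x)

  f-expand : ∀ w → dot f w ≡ coord x w * A + coord y w * dot f (basis o y)
  f-expand w = trans (cong (dot f) (proj₂ (basis-spans o w)))
    (linear-expand₂ (dot-linear f) (basis o) x≢y f⊥basis (proj₁ (basis-spans o w)))
    where
    f⊥basis : ∀ k → k ≢ x → k ≢ y → dot f (basis o k) ≡ 0ℤ
    f⊥basis k k≢x k≢y = normal-⊥ (dir-mono (F2⊆F1ˡ x≢y) (coord≡0⇒dir-F2 {true} {false}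
      (coord-basis-≢ k≢x) (coord-basis-≢ k≢y)))

  f-basis-y : dot f (basis o y) ≡ - (α * A)
  f-basis-y = trans (isolate (α * A) B)
    (trans (cong (- (α * A) +_) (i*j≡0⇒j≡0 {+[1+ j ]} (λ ()) J*[αA+B]≡0)) (ℤP.+-identityʳ (- (α * A))))
    where
    open ≡-Reasoning
    B : ℤ
    B = dot f (basis o y)
    distribute : ∀ c a b e → c * (a * b + e) ≡ (c * a) * b + c * e
    distribute = solve-∀
    isolate : ∀ a b → b ≡ - a + (a + b)
    isolate = solve-∀
    J*[αA+B]≡0 : +[1+ j ] * (α * A + B) ≡ 0ℤ
    J*[αA+B]≡0 = begin
      +[1+ j ] * (α * A + B)                                      ≡⟨ distribute +[1+ j ] α A B ⟩
      (+[1+ j ] * α) * A + +[1+ j ] * B                           ≡⟨ cong₂ (λ p q → p * A + q * B) (rise x) rise-y ⟨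
      coord x (v far -ᵥ v q₁₀) * A + coord y (v far -ᵥ v q₁₀) * B ≡⟨ f-expand (v far -ᵥ v q₁₀) ⟨
      dot f (v far -ᵥ v q₁₀)
        ≡⟨ normal-⊥ (dir-edge (∈F1 x far-x) (∈F1 x q₁₀-x)) ⟩
      0ℤ                                                          ∎

  f-formula : ∀ w → dot f w ≡ A * (coord x w - α * coord y w)
  f-formula w = begin
    dot f w                                          ≡⟨ f-expand w ⟩
    coord x w * A + coord y w * dot f (basis o y)    ≡⟨ cong (λ c → coord x w * A + coord y w * c) f-basis-y ⟩
    coord x w * A + coord y w * - (α * A)            ≡⟨ rearrange (coord x w) (coord y w) α A ⟩
    A * (coord x w - α * coord y w)                  ∎
    where
    open ≡-Reasoning
    rearrange : ∀ p q a b → p * b + q * - (a * b) ≡ b * (p - a * q)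
    rearrange = solve-∀

  A>0 : 0ℤ <ℤ A
  A>0 = 0<+[1+m]*i⇒0<i (edgeScale o x) (subst (0ℤ <ℤ_) q₁₀-rise
    (normal-rises (∈F1 x q₁₀-x) (∉F1 x (lookup-o x))))
    where
    q₁₀-rise : dot f (v q₁₀ -ᵥ v o) ≡ +[1+ edgeScale o x ] * A
    q₁₀-rise = trans (cong (dot f) (edge≡ o x)) (•-homo +[1+ edgeScale o x ] (basis o x))
      where open Linear (dot-linear f)

  convex : 0ℤ <ℤ +[1+ edgeScale o x ] + α * +[1+ edgeScale o y ]
  convex = 0<i*j∧0<i⇒0<j (subst (0ℤ <ℤ_) value
    (normal-rises (∈F1 x q₁₀-x) (∉F1 x q₀₁-x))) A>0
    where
    open ≡-Reasoning
    K L : ℤ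
    K = +[1+ edgeScale o x ]
    L = +[1+ edgeScale o y ]
    W : Pt d
    W = v q₁₀ -ᵥ v q₀₁
    W-coord : ∀ z → coord z W ≡ coord z (v q₁₀ -ᵥ v o) + - coord z (v q₀₁ -ᵥ v o)
    W-coord z = trans (-ᵥ-telescope (v q₁₀) (v o) (v q₀₁))
                      (cong (coord z (v q₁₀ -ᵥ v o) +_) (-ᵥ-antisym (v q₀₁) (v o)))
      where open Linear (coord-linear z)
    W-x : coord x W ≡ K + - 0ℤ
    W-x = trans (W-coord x) (cong₂ (λ p q → p + - q) (coord-edge x) q₀₁-coord-x)
    W-y : coord y W ≡ 0ℤ + - L
    W-y = trans (W-coord y) (cong₂ (λ p q → p + - q) q₁₀-coord-y (coord-edge y))
    simplify : ∀ a k l c → a * ((k + - 0ℤ) - c * (0ℤ + - l)) ≡ a * (k + c * l)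
    simplify = solve-∀
    value : dot f W ≡ A * (K + α * L)
    value = begin
      dot f W                                  ≡⟨ f-formula W ⟩
      A * (coord x W - α * coord y W)          ≡⟨ cong₂ (λ p q → A * (p - α * q)) W-x W-y ⟩
      A * ((K + - 0ℤ) - α * (0ℤ + - L))        ≡⟨ simplify A K L α ⟩
      A * (K + α * L)                          ∎

  flat⇒F̄⊆F : α ≡ 0ℤ → ∀ {w} → Dir (F1 x true) w → Dir (F1 x false) w
  flat⇒F̄⊆F α≡0 {w} w∈ = coord≡0⇒dir-F1 (begin
    coord x w                        ≡⟨ drop-zero (coord x w) (coord y w) ⟨
    coord x w - 0ℤ * coord y w       ≡⟨ cong (λ a → coord x w - a * coord y w) α≡0 ⟨
    coord x w - α * coord y w
      ≡⟨ i*j≡0⇒j≡0 (≢-sym (ℤP.<⇒≢ A>0)) (trans (sym (f-formula w)) (normal-⊥ w∈)) ⟩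
    0ℤ                               ∎)
    where
    open ≡-Reasoning
    drop-zero : ∀ p q → p - 0ℤ * q ≡ p
    drop-zero = solve-∀

  flat⇒F⊆F̄ : α ≡ 0ℤ → ∀ {w} → Dir (F1 x false) w → Dir (F1 x true) w
  flat⇒F⊆F̄ α≡0 {w} w∈ = dir-cancel {n = +[1+ j ]} (λ ())
    (subst (Dir (F1 x true)) (-ᵥ-+ᵥ-cancel (+[1+ j ] • w) (coord y w • E))
      (dir-+ᵥ (dir-mono (F2⊆F1ˡ x≢y) (coord≡0⇒dir-F2 {true} {false} r-x r-y)) (dir-• (coord y w) E∈)))
    where
    E : Pt d
    E = v far -ᵥ v q₁₀
    E∈ : Dir (F1 x true) E
    E∈ = dir-edge (∈F1 x far-x) (∈F1 x q₁₀-x)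
    r : Pt d
    r = (+[1+ j ] • w) -ᵥ (coord y w • E)
    r-coord : ∀ z → coord z r ≡ +[1+ j ] * coord z w - coord y w * coord z E
    r-coord z = trans (-ᵥ-homo _ _) (cong₂ _-_ (•-homo +[1+ j ] w) (•-homo (coord y w) E))
      where open Linear (coord-linear z)
    vanish-x : ∀ J c → J * 0ℤ - c * (J * 0ℤ) ≡ 0ℤ
    vanish-x = solve-∀
    vanish-y : ∀ J c → J * c - c * J ≡ 0ℤ
    vanish-y = solve-∀
    r-x : coord x r ≡ 0ℤ
    r-x = trans (r-coord x)
      (trans (cong₂ (λ p q → +[1+ j ] * p - coord y w * q) (dir-F1⇒coord≡0 w∈) (trans (rise x) (cong (+[1+ j ] *_) α≡0)))
             (vanish-x +[1+ j ] (coord y w)))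
    r-y : coord y r ≡ 0ℤ
    r-y = trans (r-coord y) (trans (cong (λ q → +[1+ j ] * coord y w - coord y w * q) rise-y)
                                   (vanish-y +[1+ j ] (coord y w)))

  flat⇒parallel : α ≡ 0ℤ → Parallel v (F1 x false) (F1 x true)
  flat⇒parallel α≡0 = dir⇒Parallel (flat⇒F⊆F̄ α≡0) (flat⇒F̄⊆F α≡0)

module Square {d : ℕ} (v : Vertices d) (comb : IsCombCube v) (smooth : IsSmooth v)
  (x y : Fin d) (x≢y : x ≢ y) (par : ∀ a b a′ b′ → Parallel v (F2 x a y b) (F2 x a′ y b′)) where

  open Coordinates v comb smooth

  module X = Corner v comb smooth x y x≢y par
  module Y = Corner v comb smooth y x (≢-sym x≢y)
    (λ a b a′ b′ → subst₂ (Parallel v) (F2-comm x≢y) (F2-comm x≢y) (par b a b′ a′))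

  far≡ : Y.far ≡ X.far
  far≡ = flip-comm o y x

  x-closes : +[1+ X.j ] * X.α + +[1+ edgeScale o x ] ≡ +[1+ Y.j ]
  x-closes = trans (sym X.far-coord-x) (trans (cong (λ η → coord x (v η -ᵥ v o)) (sym far≡)) Y.far-coord-y)

  y-closes : +[1+ Y.j ] * Y.α + +[1+ edgeScale o y ] ≡ +[1+ X.j ]
  y-closes = trans (sym Y.far-coord-x) (trans (cong (λ η → coord y (v η -ᵥ v o)) far≡) X.far-coord-y)

  unimodular : ∣ 1ℤ - X.α * Y.α ∣ ≡ 1
  unimodular = ℕP.m*n≡1⇒n≡1 ∣ P * Q ∣ _ (trans (sym (ℤP.abs-* (P * Q) _))
    (trans (cong ∣_∣ (sym factor)) (X.minor-unimodular-at X.far)))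
    where
    open ≡-Reasoning
    B : Fin d → Pt d
    B = basis X.far
    P Q : ℤ
    P = coord x (B x)
    Q = coord y (B y)
    Y-return-slope : coord y (B x) ≡ Y.α * P
    Y-return-slope = subst (λ η → coord y (basis η x) ≡ Y.α * coord x (basis η x)) far≡ Y.return-slope
    expand : ∀ p q a b → p * q - (a * q) * (b * p) ≡ (p * q) * (1ℤ - a * b)
    expand = solve-∀
    factor : X.minor X.far ≡ (P * Q) * (1ℤ - X.α * Y.α)
    factor = begin
      det₂ P (coord x (B y)) (coord y (B x)) Q   ≡⟨ cong₂ (λ b c → det₂ P b c Q) X.return-slope Y-return-slope ⟩
      det₂ P (X.α * Q) (Y.α * P) Q               ≡⟨ expand P Q X.α Y.α ⟩
      (P * Q) * (1ℤ - X.α * Y.α)                 ∎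

  slope≡0 : X.α ≡ 0ℤ ⊎ Y.α ≡ 0ℤ
  slope≡0 = quadrilateral-slope≡0 X.j Y.j (edgeScale o x) (edgeScale o y) X.α Y.α
    unimodular x-closes y-closes X.convex Y.convex

lemma3p6 : (d : ℕ) → 3 ≤ d → (v : Vertices d) → IsCombCube v → IsSmooth v
    → (∀ (d' : ℕ) → 2 ≤ d' → d' < d → (w : Vertices d') → IsCombCube w → IsSmooth w → HasParallelFacets w)
    → (x y : Fin d) → x ≢ y
    → (∀ (a b a' b' : Bool) → Parallel v (F2 x a y b) (F2 x a' y b'))
    → Parallel v (F1 x false) (F1 x true) ⊎ Parallel v (F1 y false) (F1 y true)
-- Neither 3 ≤ d nor the hypothesis on lower-dimensional cubes is needed: the planar case is
-- quadrilateral-slope≡0.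
lemma3p6 d _ v comb smooth _ x y x≢y par = Data.Sum.map X.flat⇒parallel Y.flat⇒parallel slope≡0
  where open Square v comb smooth x y x≢y par
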